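{- Let $k\ge1$ be an integer and \[ A_1=\sum_{n=1}^{\infty}\frac{(-1)^{n+1}q^{n^2+(4k+1)n+6k}}{(-q^{2k+1};q^2)_{n+1}}\sum_{i=0}^{n}\frac{q^{2i+1}}{1+q^{2i+2k+1}}. \] Then the power series $\dfrac{A_1}{(q;q^2)_{\infty}^2(q^2;q^2)_{\infty}(q^4;q^4)_{\infty}^2}$ has non-negative coefficients.
   Context: $(x;q)_n=\prod_{j=1}^{n}(1-xq^{j-1})$, $(x;q)_\infty=\prod_{j\ge1}(1-xq^{j-1})$. -}

module Defs where

open import Data.Nat as ℕ using (ℕ; zero; suc; _≡ᵇ_)
open import Data.Integer using (ℤ; +_; -_; _+_; _*_; _^_; 0ℤ; 1ℤ)
open import Data.Bool using (if_then_else_)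

-- Formal power series in q with integer coefficients: n ↦ coefficient of q^n.
FPS : Set
FPS = ℕ → ℤ

sumTo : ℕ → (ℕ → ℤ) → ℤ
sumTo zero    f = f 0
sumTo (suc n) f = sumTo n f + f (suc n)

mono : ℤ → ℕ → FPS
mono c e N = if e ≡ᵇ N then c else 0ℤ

one : FPS
one = mono 1ℤ 0

_⊗_ : FPS → FPS → FPS
(f ⊗ g) N = sumTo N (λ i → f i * g (N ℕ.∸ i))
infixl 7 _⊗_

sumS : ℕ → (ℕ → FPS) → FPS
sumS n f N = sumTo n (λ i → f i N)

prodLt : ℕ → (ℕ → FPS) → FPS
prodLt zero    f = one
prodLt (suc n) f = prodLt n f ⊗ f n

-- geo c a = 1 / (1 - c q^a) = Σ_{m≥0} c^m q^{a m}   (used only with a ≥ 1)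
geo : ℤ → ℕ → FPS
geo c a N = sumTo N (λ m → if (m ℕ.* a) ≡ᵇ N then c ^ m else 0ℤ)

-- invPoch c a d n = 1 / (c q^a ; q^d)_n = ∏_{j<n} 1/(1 - c q^{a + d j})
invPoch : ℤ → ℕ → ℕ → ℕ → FPS
invPoch c a d n = prodLt n (λ j → geo c (a ℕ.+ d ℕ.* j))

-- invPochInf c a d = 1 / (c q^a ; q^d)_∞  (for a ≥ 1, d ≥ 1): the factors with
-- j > N are 1 + O(q^{N+1}), so the coefficient of q^N is that of the
-- product over j ≤ N.
invPochInf : ℤ → ℕ → ℕ → FPS
invPochInf c a d N = invPoch c a d (suc N) N

A1term : ℕ → ℕ → FPS
A1term k n =
  mono ((- 1ℤ) ^ (suc n)) (n ℕ.* n ℕ.+ (4 ℕ.* k ℕ.+ 1) ℕ.* n ℕ.+ 6 ℕ.* k)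
  ⊗ invPoch (- 1ℤ) (2 ℕ.* k ℕ.+ 1) 2 (suc n)
  ⊗ sumS n (λ i → mono 1ℤ (2 ℕ.* i ℕ.+ 1) ⊗ geo (- 1ℤ) (2 ℕ.* i ℕ.+ 2 ℕ.* k ℕ.+ 1))

-- A_1 = Σ_{n≥1} A1term k n. The n-th term is O(q^{n²+(4k+1)n+6k+1}), so only
-- n ≤ N contribute to the coefficient of q^N.
A1 : ℕ → FPS
A1 k N = sumTo N (λ n → if n ≡ᵇ 0 then 0ℤ else A1term k n N)

denomInv : FPS
denomInv = invPochInf 1ℤ 1 2 ⊗ invPochInf 1ℤ 1 2 ⊗ invPochInf 1ℤ 2 2
           ⊗ invPochInf 1ℤ 4 4 ⊗ invPochInf 1ℤ 4 4

{-# OPTIONS --safe #-}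
module Submission where

open import Defs
open import Data.Nat using (ℕ; _≤_)
open import Data.Integer using (0ℤ) renaming (_≤_ to _≤ℤ_)

open import Algebra.Bundles using (CommutativeRing)
open import Algebra.Structures using (IsCommutativeRing)
import Algebra.Solver.Ring
import Algebra.Solver.Ring.AlmostCommutativeRing as ACR
open import Data.Bool using (true; false; T; if_then_else_)
open import Data.Empty using (⊥-elim)
open import Data.Integer as ℤ using (ℤ; -_; 1ℤ)
import Data.Integer.Properties as ℤP
open import Algebra.Properties.CommutativeSemigroup ℤP.+-commutativeSemigroup
  using () renaming (interchange to +-interchange)
open import Data.Maybe using (Maybe; just; nothing)
open import Data.Nat as ℕ
  using (zero; suc; _+_; _*_; _∸_; _<_; _≡ᵇ_; NonZero; z≤n; s≤s; z<s; _≤′_; ≤′-refl; ≤′-step)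
import Data.Nat.Properties as ℕP
open import Data.Nat.Tactic.RingSolver using (solve-∀)
open import Data.Product using (_,_; ∃-syntax)
open import Data.Sum using (inj₁; inj₂)
open import Function using (_∘_; flip)
open import Relation.Binary.PropositionalEquality
open import Relation.Nullary using (yes; no)
import Relation.Binary.Reasoning.Setoid

-- Group the terms of A₁ in pairs n, n + 1 with n odd, and put gⱼ = 1/(1 + q^(2k+1+2j)),
-- hⱼ = 1/(1 - q^(2k+1+2j)).  The pair is q^(n²+(4k+1)n+6k) g₀⋯gₙ times a bracket in which
-- only gₙ₊₁ and the inner sums occur.  Take 1/(1 - q) and h₀⋯hₙ₊₁ from one copy of 1/(q;q²)∞,
-- and 1/(1 - q^(2k-1)) and h₀⋯hₙ₊₁ from the other.  Modulo the relations defining gₙ, gₙ₊₁ and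
-- 1/(1 - q^(2k-1)), the product is then a polynomial with nonnegative coefficients in monomials,
-- the series 1/(1 - q^r), the polynomials (1 - q^r)/(1 - q) = 1 + ⋯ + q^(r-1) and the series
-- gⱼhⱼ = 1/(1 - q^(4k+2+4j)); each summand q^(2i+1)gᵢ of the inner sum is paired with the factor
-- gᵢhᵢ² of g₀h₀²⋯gₙhₙ².  The rest of the denominator has nonnegative coefficients, and a given
-- coefficient only involves finitely many terms and factors.

sumTo-cong : ∀ n {f g : ℕ → ℤ} → (∀ i → f i ≡ g i) → sumTo n f ≡ sumTo n g
sumTo-cong zero    f≡g = f≡g 0
sumTo-cong (suc n) f≡g = cong₂ ℤ._+_ (sumTo-cong n f≡g) (f≡g (suc n))

sumTo-cong-≤ : ∀ n {f g : ℕ → ℤ} → (∀ i → i ≤ n → f i ≡ g i) → sumTo n f ≡ sumTo n g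
sumTo-cong-≤ zero    f≡g = f≡g 0 z≤n
sumTo-cong-≤ (suc n) f≡g =
  cong₂ ℤ._+_ (sumTo-cong-≤ n (λ i i≤n → f≡g i (ℕP.m≤n⇒m≤1+n i≤n)))
              (f≡g (suc n) ℕP.≤-refl)

sumTo-zero : ∀ n {f : ℕ → ℤ} → (∀ i → i ≤ n → f i ≡ 0ℤ) → sumTo n f ≡ 0ℤ
sumTo-zero zero    f≡0 = f≡0 0 z≤n
sumTo-zero (suc n) f≡0 =
  cong₂ ℤ._+_ (sumTo-zero n (λ i i≤n → f≡0 i (ℕP.m≤n⇒m≤1+n i≤n)))
              (f≡0 (suc n) ℕP.≤-refl)

sumTo-nonneg : ∀ n {f : ℕ → ℤ} → (∀ i → i ≤ n → 0ℤ ≤ℤ f i) → 0ℤ ≤ℤ sumTo n f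
sumTo-nonneg zero    f≥0 = f≥0 0 z≤n
sumTo-nonneg (suc n) f≥0 =
  ℤP.+-mono-≤ (sumTo-nonneg n (λ i i≤n → f≥0 i (ℕP.m≤n⇒m≤1+n i≤n)))
              (f≥0 (suc n) ℕP.≤-refl)

sumTo-distrib-+ : ∀ n (f g : ℕ → ℤ) →
                  sumTo n (λ i → f i ℤ.+ g i) ≡ sumTo n f ℤ.+ sumTo n g
sumTo-distrib-+ zero    f g = refl
sumTo-distrib-+ (suc n) f g =
  trans (cong (ℤ._+ (f (suc n) ℤ.+ g (suc n))) (sumTo-distrib-+ n f g))
        (+-interchange (sumTo n f) (sumTo n g) (f (suc n)) (g (suc n)))

*-distribˡ-sumTo : ∀ n c (f : ℕ → ℤ) → c ℤ.* sumTo n f ≡ sumTo n (λ i → c ℤ.* f i)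
*-distribˡ-sumTo zero    c f = refl
*-distribˡ-sumTo (suc n) c f =
  trans (ℤP.*-distribˡ-+ c (sumTo n f) (f (suc n)))
        (cong (ℤ._+ c ℤ.* f (suc n)) (*-distribˡ-sumTo n c f))

*-distribʳ-sumTo : ∀ n c (f : ℕ → ℤ) → sumTo n f ℤ.* c ≡ sumTo n (λ i → f i ℤ.* c)
*-distribʳ-sumTo n c f =
  trans (ℤP.*-comm (sumTo n f) c)
        (trans (*-distribˡ-sumTo n c f) (sumTo-cong n (λ i → ℤP.*-comm c (f i))))

sumTo-head : ∀ n (f : ℕ → ℤ) → sumTo (suc n) f ≡ f 0 ℤ.+ sumTo n (f ∘ suc)
sumTo-head zero    f = refl
sumTo-head (suc n) f =
  trans (cong (ℤ._+ f (suc (suc n))) (sumTo-head n f)) (ℤP.+-assoc (f 0) _ _)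

sumTo-reverse : ∀ n (f : ℕ → ℤ) → sumTo n f ≡ sumTo n (λ i → f (n ∸ i))
sumTo-reverse zero    f = refl
sumTo-reverse (suc n) f = begin
  sumTo n f ℤ.+ f (suc n)                  ≡⟨ cong (ℤ._+ f (suc n)) (sumTo-reverse n f) ⟩
  sumTo n (λ i → f (n ∸ i)) ℤ.+ f (suc n)  ≡⟨ ℤP.+-comm _ (f (suc n)) ⟩
  f (suc n) ℤ.+ sumTo n (λ i → f (n ∸ i))  ≡⟨ sym (sumTo-head n (λ i → f (suc n ∸ i))) ⟩
  sumTo (suc n) (λ i → f (suc n ∸ i))      ∎
  where open ≡-Reasoning

sumTo-trailing-zeros : ∀ {n m} {f : ℕ → ℤ} → n ≤ m →
                       (∀ i → n < i → i ≤ m → f i ≡ 0ℤ) → sumTo m f ≡ sumTo n f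
sumTo-trailing-zeros {n} {f = f} n≤m = go (ℕP.≤⇒≤′ n≤m)
  where
  go : ∀ {m} → n ≤′ m → (∀ i → n < i → i ≤ m → f i ≡ 0ℤ) → sumTo m f ≡ sumTo n f
  go ≤′-refl                  _   = refl
  go {suc m} (≤′-step n≤′m) f≡0 = begin
    sumTo m f ℤ.+ f (suc m)
      ≡⟨ cong₂ ℤ._+_ (go n≤′m (λ i n<i i≤m → f≡0 i n<i (ℕP.m≤n⇒m≤1+n i≤m)))
                     (f≡0 (suc m) (s≤s (ℕP.≤′⇒≤ n≤′m)) ℕP.≤-refl) ⟩
    sumTo n f ℤ.+ 0ℤ
      ≡⟨ ℤP.+-identityʳ (sumTo n f) ⟩
    sumTo n f ∎
    where open ≡-Reasoning

sumTo-triangle : ∀ n (F : ℕ → ℕ → ℤ) →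
                 sumTo n (λ i → sumTo i (F i)) ≡ sumTo n (λ j → sumTo (n ∸ j) (λ l → F (j + l) j))
sumTo-triangle zero    F = refl
sumTo-triangle (suc n) F = begin
  sumTo n (λ i → sumTo i (F i)) ℤ.+ (sumTo n (F (suc n)) ℤ.+ F (suc n) (suc n))
    ≡⟨ cong (ℤ._+ (sumTo n (F (suc n)) ℤ.+ F (suc n) (suc n))) (sumTo-triangle n F) ⟩
  swapped n ℤ.+ (sumTo n (F (suc n)) ℤ.+ F (suc n) (suc n))
    ≡⟨ sym (ℤP.+-assoc (swapped n) (sumTo n (F (suc n))) (F (suc n) (suc n))) ⟩
  swapped n ℤ.+ sumTo n (F (suc n)) ℤ.+ F (suc n) (suc n)
    ≡⟨ cong₂ ℤ._+_ (sym (sumTo-distrib-+ n (row n) (F (suc n)))) diagonal ⟩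
  sumTo n (λ j → row n j ℤ.+ F (suc n) j) ℤ.+ row (suc n) (suc n)
    ≡⟨ cong (ℤ._+ row (suc n) (suc n)) (sumTo-cong-≤ n extend) ⟩
  swapped (suc n) ∎
  where
  open ≡-Reasoning
  row : ℕ → ℕ → ℤ
  row m j = sumTo (m ∸ j) (λ l → F (j + l) j)
  swapped : ℕ → ℤ
  swapped m = sumTo m (row m)
  diagonal : F (suc n) (suc n) ≡ row (suc n) (suc n)
  diagonal rewrite ℕP.n∸n≡0 n | ℕP.+-identityʳ n = refl
  extend : ∀ j → j ≤ n → row n j ℤ.+ F (suc n) j ≡ row (suc n) j
  extend j j≤n rewrite ℕP.+-∸-assoc 1 j≤n =
    cong (λ z → row n j ℤ.+ F z j)
         (sym (trans (ℕP.+-suc j (n ∸ j)) (cong suc (ℕP.m+[n∸m]≡n j≤n))))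

infix 4 _≈_
record _≈_ (f g : FPS) : Set where
  constructor coeffwise
  field coeff : ∀ N → f N ≡ g N
open _≈_

infixl 6 _⊕_ _⊖_
_⊕_ : FPS → FPS → FPS
(f ⊕ g) N = f N ℤ.+ g N

⊝_ : FPS → FPS
(⊝ f) N = - f N

_⊖_ : FPS → FPS → FPS
f ⊖ g = f ⊕ ⊝ g

0S : FPS
0S _ = 0ℤ

X^ : ℕ → FPS
X^ = mono 1ℤ

mono-≡ : ∀ c e → mono c e e ≡ c
mono-≡ c zero    = refl
mono-≡ c (suc e) = mono-≡ c e

mono-≢ : ∀ c e N → e ≢ N → mono c e N ≡ 0ℤ
mono-≢ c e N e≢N with e ≡ᵇ N in eq
... | true  = ⊥-elim (e≢N (ℕP.≡ᵇ⇒≡ e N (subst T (sym eq) _)))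
... | false = refl

mono-neg : ∀ c e N → mono (- c) e N ≡ - mono c e N
mono-neg c e N with e ≡ᵇ N
... | true  = refl
... | false = refl

mono-* : ∀ c d e N → mono (c ℤ.* d) e N ≡ c ℤ.* mono d e N
mono-* c d e N with e ≡ᵇ N
... | true  = refl
... | false = sym (ℤP.*-zeroʳ c)

mono-+ˡ : ∀ c a e N → mono c (a + e) (a + N) ≡ mono c e N
mono-+ˡ c zero    e N = refl
mono-+ˡ c (suc a) e N = mono-+ˡ c a e N

sumTo-mono-< : ∀ c e N (f : ℕ → ℤ) → N < e → sumTo N (λ i → mono c e i ℤ.* f i) ≡ 0ℤ
sumTo-mono-< c e N f N<e = sumTo-zero N (λ i i≤N →
  cong (ℤ._* f i) (mono-≢ c e i (λ e≡i → ℕP.<⇒≢ (ℕP.≤-<-trans i≤N N<e) (sym e≡i))))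

sumTo-mono-≤ : ∀ c e N (f : ℕ → ℤ) → e ≤ N →
               sumTo N (λ i → mono c e i ℤ.* f i) ≡ c ℤ.* f e
sumTo-mono-≤ c zero zero f z≤n = refl
sumTo-mono-≤ c e (suc N) f e≤1+N with ℕP.m≤n⇒m<n∨m≡n e≤1+N
... | inj₁ (s≤s e≤N) = begin
  sumTo N (λ i → mono c e i ℤ.* f i) ℤ.+ mono c e (suc N) ℤ.* f (suc N)
    ≡⟨ cong₂ ℤ._+_ (sumTo-mono-≤ c e N f e≤N)
                   (cong (ℤ._* f (suc N)) (mono-≢ c e (suc N) (ℕP.<⇒≢ (s≤s e≤N)))) ⟩
  c ℤ.* f e ℤ.+ 0ℤ
    ≡⟨ ℤP.+-identityʳ (c ℤ.* f e) ⟩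
  c ℤ.* f e ∎
  where open ≡-Reasoning
... | inj₂ refl =
  trans (cong₂ ℤ._+_ (sumTo-mono-< c e N f ℕP.≤-refl) (cong (ℤ._* f e) (mono-≡ c e)))
        (ℤP.+-identityˡ (c ℤ.* f e))

mono-⊗-≤ : ∀ c e f N → e ≤ N → (mono c e ⊗ f) N ≡ c ℤ.* f (N ∸ e)
mono-⊗-≤ c e f N = sumTo-mono-≤ c e N (λ i → f (N ∸ i))

mono-⊗-< : ∀ c e f N → N < e → (mono c e ⊗ f) N ≡ 0ℤ
mono-⊗-< c e f N = sumTo-mono-< c e N (λ i → f (N ∸ i))

mono-⊗-mono : ∀ c d e e′ N → (mono c e ⊗ mono d e′) N ≡ mono (c ℤ.* d) (e + e′) N
mono-⊗-mono c d e e′ N with e ℕP.≤? N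
... | no e≰N = trans (mono-⊗-< c e (mono d e′) N (ℕP.≰⇒> e≰N))
                     (sym (mono-≢ _ _ N (λ eq → e≰N (subst (e ≤_) eq (ℕP.m≤m+n e e′)))))
... | yes e≤N = begin
  (mono c e ⊗ mono d e′) N                ≡⟨ mono-⊗-≤ c e (mono d e′) N e≤N ⟩
  c ℤ.* mono d e′ (N ∸ e)                 ≡⟨ sym (mono-* c d e′ (N ∸ e)) ⟩
  mono (c ℤ.* d) e′ (N ∸ e)               ≡⟨ sym (mono-+ˡ (c ℤ.* d) e e′ (N ∸ e)) ⟩
  mono (c ℤ.* d) (e + e′) (e + (N ∸ e))   ≡⟨ cong (mono (c ℤ.* d) (e + e′)) (ℕP.m+[n∸m]≡n e≤N) ⟩
  mono (c ℤ.* d) (e + e′) N               ∎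
  where open ≡-Reasoning

⊗-cong : ∀ {f f′ g g′} → f ≈ f′ → g ≈ g′ → f ⊗ g ≈ f′ ⊗ g′
⊗-cong f≈f′ g≈g′ = coeffwise λ N →
  sumTo-cong N (λ i → cong₂ ℤ._*_ (coeff f≈f′ i) (coeff g≈g′ (N ∸ i)))

⊗-comm : ∀ f g → f ⊗ g ≈ g ⊗ f
⊗-comm f g = coeffwise λ N → trans (sumTo-reverse N _) (sumTo-cong-≤ N (λ i i≤N →
  trans (cong (λ j → f (N ∸ i) ℤ.* g j) (ℕP.m∸[m∸n]≡n i≤N)) (ℤP.*-comm (f (N ∸ i)) (g i))))

⊗-assoc : ∀ f g h → (f ⊗ g) ⊗ h ≈ f ⊗ (g ⊗ h)
⊗-assoc f g h = coeffwise λ N → begin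
  sumTo N (λ i → sumTo i (λ j → f j ℤ.* g (i ∸ j)) ℤ.* h (N ∸ i))
    ≡⟨ sumTo-cong N (λ i → *-distribʳ-sumTo i (h (N ∸ i)) _) ⟩
  sumTo N (λ i → sumTo i (λ j → f j ℤ.* g (i ∸ j) ℤ.* h (N ∸ i)))
    ≡⟨ sumTo-triangle N (λ i j → f j ℤ.* g (i ∸ j) ℤ.* h (N ∸ i)) ⟩
  sumTo N (λ j → sumTo (N ∸ j) (λ l → f j ℤ.* g (j + l ∸ j) ℤ.* h (N ∸ (j + l))))
    ≡⟨ sumTo-cong N (λ j → sumTo-cong (N ∸ j) (λ l →
         trans (cong₂ (λ a b → f j ℤ.* g a ℤ.* h b) (ℕP.m+n∸m≡n j l) (sym (ℕP.∸-+-assoc N j l)))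
               (ℤP.*-assoc (f j) (g l) (h (N ∸ j ∸ l))))) ⟩
  sumTo N (λ j → sumTo (N ∸ j) (λ l → f j ℤ.* (g l ℤ.* h (N ∸ j ∸ l))))
    ≡⟨ sumTo-cong N (λ j → sym (*-distribˡ-sumTo (N ∸ j) (f j) _)) ⟩
  (f ⊗ (g ⊗ h)) N ∎
  where open ≡-Reasoning

⊗-distribˡ-⊕ : ∀ f g h → f ⊗ (g ⊕ h) ≈ f ⊗ g ⊕ f ⊗ h
⊗-distribˡ-⊕ f g h = coeffwise λ N →
  trans (sumTo-cong N (λ i → ℤP.*-distribˡ-+ (f i) (g (N ∸ i)) (h (N ∸ i))))
        (sumTo-distrib-+ N _ _)

⊗-distribʳ-⊕ : ∀ f g h → (g ⊕ h) ⊗ f ≈ g ⊗ f ⊕ h ⊗ f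
⊗-distribʳ-⊕ f g h = coeffwise λ N →
  trans (sumTo-cong N (λ i → ℤP.*-distribʳ-+ (f (N ∸ i)) (g i) (h i)))
        (sumTo-distrib-+ N _ _)

⊗-identityˡ : ∀ f → one ⊗ f ≈ f
⊗-identityˡ f = coeffwise λ N → trans (mono-⊗-≤ 1ℤ 0 f N z≤n) (ℤP.*-identityˡ (f N))

⊗-identityʳ : ∀ f → f ⊗ one ≈ f
⊗-identityʳ f = coeffwise λ N → trans (coeff (⊗-comm f one) N) (coeff (⊗-identityˡ f) N)

FPS-isCommutativeRing : IsCommutativeRing _≈_ _⊕_ _⊗_ ⊝_ 0S one
FPS-isCommutativeRing = record
  { isRing = record
    { +-isAbelianGroup = record
      { isGroup = record
        { isMonoid = record
          { isSemigroup = record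
            { isMagma = record
              { isEquivalence = record
                { refl  = coeffwise λ _ → refl
                ; sym   = λ f≈g → coeffwise λ N → sym (coeff f≈g N)
                ; trans = λ f≈g g≈h → coeffwise λ N → trans (coeff f≈g N) (coeff g≈h N)
                }
              ; ∙-cong = λ f≈f′ g≈g′ → coeffwise λ N →
                           cong₂ ℤ._+_ (coeff f≈f′ N) (coeff g≈g′ N)
              }
            ; assoc = λ f g h → coeffwise λ N → ℤP.+-assoc (f N) (g N) (h N)
            }
          ; identity = (λ f → coeffwise λ N → ℤP.+-identityˡ (f N))
                     , (λ f → coeffwise λ N → ℤP.+-identityʳ (f N))
          }
        ; inverse = (λ f → coeffwise λ N → ℤP.+-inverseˡ (f N))
                  , (λ f → coeffwise λ N → ℤP.+-inverseʳ (f N))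
        ; ⁻¹-cong = λ f≈g → coeffwise λ N → cong -_ (coeff f≈g N)
        }
      ; comm = λ f g → coeffwise λ N → ℤP.+-comm (f N) (g N)
      }
    ; *-cong     = ⊗-cong
    ; *-assoc    = ⊗-assoc
    ; *-identity = ⊗-identityˡ , ⊗-identityʳ
    ; distrib    = ⊗-distribˡ-⊕ , ⊗-distribʳ-⊕
    }
  ; *-comm = ⊗-comm
  }

FPS-commutativeRing : CommutativeRing _ _
FPS-commutativeRing = record { isCommutativeRing = FPS-isCommutativeRing }

module R = CommutativeRing FPS-commutativeRing
module ≈-Reasoning = Relation.Binary.Reasoning.Setoid R.setoid
open import Algebra.Properties.CommutativeSemigroup R.*-commutativeSemigroup
  using (x∙yz≈y∙xz) renaming (interchange to ⊗-interchange)
open import Algebra.Properties.Group R.+-group using (x≈y⇒x∙y⁻¹≈ε)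

-- The constants c q⁰ embed ℤ in the series ring, so the ring solver can use integer coefficients.
constant-morphism : ACR._-Raw-AlmostCommutative⟶_ (CommutativeRing.rawRing ℤP.+-*-commutativeRing)
                                                   (ACR.fromCommutativeRing FPS-commutativeRing)
constant-morphism = record
  { ⟦_⟧    = λ c → mono c 0
  ; +-homo = λ c d → coeffwise λ { zero → refl ; (suc N) → refl }
  ; *-homo = λ c d → coeffwise λ N → sym (mono-⊗-mono c d 0 0 N)
  ; -‿homo = λ c → coeffwise (mono-neg c 0)
  ; 0-homo = coeffwise λ { zero → refl ; (suc N) → refl }
  ; 1-homo = R.refl
  }

constants-≈? : ∀ c d → Maybe (mono c 0 ≈ mono d 0)
constants-≈? c d with c ℤ.≟ d
... | yes refl = just R.refl
... | no _     = nothing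

module Solver = Algebra.Solver.Ring _ _ constant-morphism constants-≈?

X^-+ : ∀ a b → X^ (a + b) ≈ X^ a ⊗ X^ b
X^-+ a b = coeffwise λ N → sym (mono-⊗-mono 1ℤ 1ℤ a b N)

X^-+1+1 : ∀ a → X^ (a + 1 + 1) ≈ X^ a ⊗ X^ 1 ⊗ X^ 1
X^-+1+1 a = R.trans (X^-+ (a + 1) 1) (R.*-congʳ {X^ 1} (X^-+ a 1))

⊗-distrib-one⊖ : ∀ f g → f ⊗ (one ⊖ g) ≈ f ⊖ g ⊗ f
⊗-distrib-one⊖ = solve 2 (λ f g → f :* (con 1ℤ :- g) := f :- g :* f) R.refl
  where open Solver

≈-modulo : ∀ {p r s} q K → r ≈ s → p ≈ q ⊕ (r ⊖ s) ⊗ K → p ≈ q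
≈-modulo {p} {r} {s} q K r≈s p≈ = begin
  p                ≈⟨ p≈ ⟩
  q ⊕ (r ⊖ s) ⊗ K  ≈⟨ R.+-congˡ {q} (R.*-congʳ {K} (x≈y⇒x∙y⁻¹≈ε {r} {s} r≈s)) ⟩
  q ⊕ 0S ⊗ K       ≈⟨ R.+-congˡ {q} (R.zeroˡ K) ⟩
  q ⊕ 0S           ≈⟨ R.+-identityʳ q ⟩
  q                ∎
  where open ≈-Reasoning

inverse-unique : ∀ {f g u} → f ⊗ u ≈ one → g ⊗ u ≈ one → f ≈ g
inverse-unique {f} {g} {u} fu≈1 gu≈1 = begin
  f            ≈⟨ R.sym (R.*-identityʳ f) ⟩
  f ⊗ one      ≈⟨ R.*-congˡ {f} (R.sym gu≈1) ⟩
  f ⊗ (g ⊗ u)  ≈⟨ x∙yz≈y∙xz f g u ⟩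
  g ⊗ (f ⊗ u)  ≈⟨ R.*-congˡ {g} fu≈1 ⟩
  g ⊗ one      ≈⟨ R.*-identityʳ g ⟩
  g            ∎
  where open ≈-Reasoning

record NonNeg (f : FPS) : Set where
  constructor coeffwise-≥0
  field coeff-≥0 : ∀ N → 0ℤ ≤ℤ f N
open NonNeg

nonneg-resp : ∀ {f g} → f ≈ g → NonNeg f → NonNeg g
nonneg-resp f≈g f≥0 = coeffwise-≥0 λ N → subst (0ℤ ≤ℤ_) (coeff f≈g N) (coeff-≥0 f≥0 N)

nonneg-⊕ : ∀ {f g} → NonNeg f → NonNeg g → NonNeg (f ⊕ g)
nonneg-⊕ f≥0 g≥0 = coeffwise-≥0 λ N → ℤP.+-mono-≤ (coeff-≥0 f≥0 N) (coeff-≥0 g≥0 N)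

nonneg-⊗ : ∀ {f g} → NonNeg f → NonNeg g → NonNeg (f ⊗ g)
nonneg-⊗ f≥0 g≥0 = coeffwise-≥0 λ N →
  sumTo-nonneg N (λ i _ → 0≤i*j (coeff-≥0 f≥0 i) (coeff-≥0 g≥0 (N ∸ i)))
  where
  0≤i*j : ∀ {i j} → 0ℤ ≤ℤ i → 0ℤ ≤ℤ j → 0ℤ ≤ℤ i ℤ.* j
  0≤i*j {ℤ.+ a} {ℤ.+ b} _ _ = subst (0ℤ ≤ℤ_) (ℤP.pos-* a b) (ℤ.+≤+ z≤n)

nonneg-mono : ∀ {c} e → 0ℤ ≤ℤ c → NonNeg (mono c e)
nonneg-mono {c} e c≥0 = coeffwise-≥0 coefficient
  where
  coefficient : ∀ N → 0ℤ ≤ℤ mono c e N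
  coefficient N with e ≡ᵇ N
  ... | true  = c≥0
  ... | false = ℤP.≤-refl

nonneg-⊗-sumS : ∀ n (F : ℕ → FPS) {x} → (∀ i → i ≤ n → NonNeg (x ⊗ F i)) →
                NonNeg (x ⊗ sumS n F)
nonneg-⊗-sumS zero    F xF≥0 = xF≥0 0 z≤n
nonneg-⊗-sumS (suc n) F {x} xF≥0 =
  nonneg-resp (R.sym (⊗-distribˡ-⊕ x (sumS n F) (F (suc n))))
    (nonneg-⊕ (nonneg-⊗-sumS n F {x} (λ i i≤n → xF≥0 i (ℕP.m≤n⇒m≤1+n i≤n)))
              (xF≥0 (suc n) ℕP.≤-refl))

infix 4 _∣⁺_
record _∣⁺_ (f g : FPS) : Set where
  constructor factorisation
  field
    cofactor        : FPS
    cofactor-nonneg : NonNeg cofactor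
    factorises      : g ≈ f ⊗ cofactor

∣⁺-refl : ∀ f → f ∣⁺ f
∣⁺-refl f = factorisation one (nonneg-mono 0 (ℤ.+≤+ z≤n)) (R.sym (R.*-identityʳ f))

∣⁺-trans : ∀ {f g h} → f ∣⁺ g → g ∣⁺ h → f ∣⁺ h
∣⁺-trans {f} (factorisation c c≥0 g≈fc) (factorisation d d≥0 h≈gd) =
  factorisation (c ⊗ d) (nonneg-⊗ c≥0 d≥0)
                (R.trans h≈gd (R.trans (R.*-congʳ {d} g≈fc) (R.*-assoc f c d)))

∣⁺-respʳ : ∀ {f g g′} → g ≈ g′ → f ∣⁺ g → f ∣⁺ g′
∣⁺-respʳ g≈g′ (factorisation c c≥0 g≈fc) =
  factorisation c c≥0 (R.trans (R.sym g≈g′) g≈fc)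

∣⁺-⊗ : ∀ {f f′ g g′} → f ∣⁺ g → f′ ∣⁺ g′ → f ⊗ f′ ∣⁺ g ⊗ g′
∣⁺-⊗ {f} {f′} (factorisation c c≥0 g≈fc) (factorisation c′ c′≥0 g′≈f′c′) =
  factorisation (c ⊗ c′) (nonneg-⊗ c≥0 c′≥0)
                (R.trans (R.*-cong g≈fc g′≈f′c′) (⊗-interchange f c f′ c′))

∣⁺-⊗-nonneg : ∀ {f g c} → f ∣⁺ g → NonNeg c → f ∣⁺ g ⊗ c
∣⁺-⊗-nonneg {f} {c = c} (factorisation d d≥0 g≈fd) c≥0 =
  factorisation (d ⊗ c) (nonneg-⊗ d≥0 c≥0) (R.trans (R.*-congʳ {c} g≈fd) (R.*-assoc f d c))

nonneg-∣⁺ : ∀ x {f g} → NonNeg (x ⊗ f) → f ∣⁺ g → NonNeg (x ⊗ g)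
nonneg-∣⁺ x {f} xf≥0 (factorisation c c≥0 g≈fc) =
  nonneg-resp (R.trans (R.*-assoc x f c) (R.*-congˡ {x} (R.sym g≈fc))) (nonneg-⊗ xf≥0 c≥0)

Monomial : FPS → Set
Monomial f = ∃[ e ] f ≈ X^ e

monomial-X^ : ∀ e → Monomial (X^ e)
monomial-X^ e = e , R.refl

monomial-⊗ : ∀ {f g} → Monomial f → Monomial g → Monomial (f ⊗ g)
monomial-⊗ (e , f≈) (e′ , g≈) = e + e′ , R.trans (R.*-cong f≈ g≈) (R.sym (X^-+ e e′))

monomial-nonneg : ∀ {f} → Monomial f → NonNeg f
monomial-nonneg (e , f≈) = nonneg-resp (R.sym f≈) (nonneg-mono e (ℤ.+≤+ z≤n))

geo-vanishes : ∀ c a N → 0 < N → N < a → geo c a N ≡ 0ℤ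
geo-vanishes c a N 0<N N<a = sumTo-zero N (λ m _ → mono-≢ _ (m * a) N (m*a≢N m))
  where
  m*a≢N : ∀ m → m * a ≢ N
  m*a≢N zero    eq = ℕP.<⇒≢ 0<N eq
  m*a≢N (suc m) eq = ℕP.<⇒≢ (ℕP.<-≤-trans N<a (ℕP.m≤m+n a (m * a))) (sym eq)

geo-shift : ∀ c a .{{_ : NonZero a}} M → geo c a (a + M) ≡ c ℤ.* geo c a M
geo-shift c a@(suc a′) M = begin
  geo c a (a + M)
    ≡⟨ sumTo-head (a′ + M) (λ m → mono (c ℤ.^ m) (m * a) (a + M)) ⟩
  0ℤ ℤ.+ sumTo (a′ + M) (λ m → mono (c ℤ.^ suc m) (a + m * a) (a + M))
    ≡⟨ ℤP.+-identityˡ _ ⟩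
  sumTo (a′ + M) (λ m → mono (c ℤ.^ suc m) (a + m * a) (a + M))
    ≡⟨ sumTo-cong (a′ + M) (λ m →
         trans (mono-+ˡ _ a (m * a) M) (mono-* c (c ℤ.^ m) (m * a) M)) ⟩
  sumTo (a′ + M) (λ m → c ℤ.* term m)
    ≡⟨ sym (*-distribˡ-sumTo (a′ + M) c term) ⟩
  c ℤ.* sumTo (a′ + M) term
    ≡⟨ cong (c ℤ.*_) (sumTo-trailing-zeros (ℕP.m≤n+m M a′) (λ m M<m _ →
         mono-≢ _ (m * a) M (λ eq → ℕP.<⇒≢ (ℕP.<-≤-trans M<m (ℕP.m≤m*n m a)) (sym eq)))) ⟩
  c ℤ.* geo c a M ∎
  where
  open ≡-Reasoning
  term : ℕ → ℤ
  term m = mono (c ℤ.^ m) (m * a) M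

geo-inverse : ∀ c a .{{_ : NonZero a}} → geo c a ⊗ (one ⊖ mono c a) ≈ one
geo-inverse c a@(suc _) = R.trans (⊗-distrib-one⊖ (geo c a) (mono c a)) (coeffwise coefficient)
  where
  coefficient : ∀ N → (geo c a ⊖ mono c a ⊗ geo c a) N ≡ one N
  coefficient zero    = cong (λ z → 1ℤ ℤ.- z) (mono-⊗-< c a (geo c a) 0 z<s)
  coefficient (suc N) with a ℕP.≤? suc N
  ... | no a≰N  = cong₂ ℤ._-_ (geo-vanishes c a (suc N) z<s (ℕP.≰⇒> a≰N))
                              (mono-⊗-< c a (geo c a) (suc N) (ℕP.≰⇒> a≰N))
  ... | yes a≤N = begin
    geo c a (suc N) ℤ.- (mono c a ⊗ geo c a) (suc N)
      ≡⟨ cong₂ ℤ._-_ (trans (cong (geo c a) (sym (ℕP.m+[n∸m]≡n a≤N))) (geo-shift c a (suc N ∸ a)))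
                     (mono-⊗-≤ c a (geo c a) (suc N) a≤N) ⟩
    c ℤ.* geo c a (suc N ∸ a) ℤ.- c ℤ.* geo c a (suc N ∸ a)
      ≡⟨ ℤP.+-inverseʳ (c ℤ.* geo c a (suc N ∸ a)) ⟩
    0ℤ ∎
    where open ≡-Reasoning

geo-1ℤ-nonneg : ∀ a → NonNeg (geo 1ℤ a)
geo-1ℤ-nonneg a = coeffwise-≥0 λ N → sumTo-nonneg N (λ m _ →
  coeff-≥0 (nonneg-mono (m * a) (subst (0ℤ ≤ℤ_) (sym (ℤP.^-zeroˡ m)) (ℤ.+≤+ z≤n))) N)

geo-1ℤ-1 : ∀ N → geo 1ℤ 1 N ≡ 1ℤ
geo-1ℤ-1 zero    = refl
geo-1ℤ-1 (suc N) = trans (geo-shift 1ℤ 1 N) (trans (ℤP.*-identityˡ _) (geo-1ℤ-1 N))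

-- (1 - q^e)/(1 - q) = 1 + q + ⋯ + q^(e-1)
geo-1ℤ-1⊗[one⊖monomial]-nonneg : ∀ {f} → Monomial f → NonNeg (geo 1ℤ 1 ⊗ (one ⊖ f))
geo-1ℤ-1⊗[one⊖monomial]-nonneg {f} (e , f≈X^e) =
  nonneg-resp (R.sym (R.trans (⊗-distrib-one⊖ h₁ f)
                              (R.+-congˡ {h₁} (R.-‿cong (R.*-congʳ {h₁} f≈X^e)))))
              (coeffwise-≥0 coefficient)
  where
  h₁ : FPS
  h₁ = geo 1ℤ 1
  coefficient : ∀ N → 0ℤ ≤ℤ (h₁ ⊖ X^ e ⊗ h₁) N
  coefficient N with e ℕP.≤? N
  ... | yes e≤N = ℤP.≤-reflexive (sym (cong₂ ℤ._-_ (geo-1ℤ-1 N)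
                    (trans (mono-⊗-≤ 1ℤ e h₁ N e≤N) (cong (1ℤ ℤ.*_) (geo-1ℤ-1 (N ∸ e))))))
  ... | no e≰N  = subst (0ℤ ≤ℤ_)
                    (sym (cong₂ ℤ._-_ (geo-1ℤ-1 N) (mono-⊗-< 1ℤ e h₁ N (ℕP.≰⇒> e≰N))))
                    (ℤ.+≤+ z≤n)

geo-[-1ℤ]-inverse : ∀ m .{{_ : NonZero m}} → geo (- 1ℤ) m ⊗ (one ⊕ X^ m) ≈ one
geo-[-1ℤ]-inverse m = R.trans (R.*-congˡ {geo (- 1ℤ) m} (R.+-congˡ {one} (coeffwise X^≡⊝mono)))
                              (geo-inverse (- 1ℤ) m)
  where
  X^≡⊝mono : ∀ N → X^ m N ≡ (⊝ mono (- 1ℤ) m) N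
  X^≡⊝mono N with m ≡ᵇ N
  ... | true  = refl
  ... | false = refl

geo-[-1ℤ]⊗geo-1ℤ : ∀ m .{{_ : NonZero m}} → geo (- 1ℤ) m ⊗ geo 1ℤ m ≈ geo 1ℤ (m + m)
geo-[-1ℤ]⊗geo-1ℤ m@(suc _) =
  inverse-unique {u = one ⊖ X^ (m + m)} product-inverse (geo-inverse 1ℤ (m + m))
  where
  open ≈-Reasoning
  g h X : FPS
  g = geo (- 1ℤ) m
  h = geo 1ℤ m
  X = X^ m
  product-inverse : g ⊗ h ⊗ (one ⊖ X^ (m + m)) ≈ one
  product-inverse = begin
    g ⊗ h ⊗ (one ⊖ X^ (m + m))       ≈⟨ R.*-congˡ {g ⊗ h} (R.+-congˡ {one} (R.-‿cong (X^-+ m m))) ⟩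
    g ⊗ h ⊗ (one ⊖ X ⊗ X)            ≈⟨ solve 3 (λ g h X → g :* h :* (con 1ℤ :- X :* X)
                                                      := g :* (con 1ℤ :+ X) :* (h :* (con 1ℤ :- X)))
                                                R.refl g h X ⟩
    g ⊗ (one ⊕ X) ⊗ (h ⊗ (one ⊖ X))  ≈⟨ R.*-cong (geo-[-1ℤ]-inverse m) (geo-inverse 1ℤ m) ⟩
    one ⊗ one                        ≈⟨ ⊗-identityˡ one ⟩
    one                              ∎
    where open Solver

geo-[-1ℤ]⊗geo-1ℤ-nonneg : ∀ m .{{_ : NonZero m}} → NonNeg (geo (- 1ℤ) m ⊗ geo 1ℤ m)
geo-[-1ℤ]⊗geo-1ℤ-nonneg m =
  nonneg-resp (R.sym (geo-[-1ℤ]⊗geo-1ℤ m)) (geo-1ℤ-nonneg (m + m))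

prodLt-nonneg : ∀ n {f : ℕ → FPS} → (∀ j → NonNeg (f j)) → NonNeg (prodLt n f)
prodLt-nonneg zero    f≥0 = nonneg-mono 0 (ℤ.+≤+ z≤n)
prodLt-nonneg (suc n) f≥0 = nonneg-⊗ (prodLt-nonneg n f≥0) (f≥0 n)

prodLt-+ : ∀ a b (f : ℕ → FPS) → prodLt (a + b) f ≈ prodLt a f ⊗ prodLt b (λ j → f (a + j))
prodLt-+ a zero    f rewrite ℕP.+-identityʳ a = R.sym (⊗-identityʳ (prodLt a f))
prodLt-+ a (suc b) f rewrite ℕP.+-suc a b =
  R.trans (R.*-congʳ {f (a + b)} (prodLt-+ a b f))
          (R.*-assoc (prodLt a f) (prodLt b (λ j → f (a + j))) (f (a + b)))

prodLt-⊗ : ∀ n (f g : ℕ → FPS) → prodLt n f ⊗ prodLt n g ≈ prodLt n (λ j → f j ⊗ g j)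
prodLt-⊗ zero    f g = ⊗-identityˡ one
prodLt-⊗ (suc n) f g = R.trans (⊗-interchange (prodLt n f) (f n) (prodLt n g) (g n))
                               (R.*-congʳ {f n ⊗ g n} (prodLt-⊗ n f g))

factor-∣⁺-prodLt : ∀ {i n} {f : ℕ → FPS} → (∀ j → NonNeg (f j)) → i < n →
                   f i ∣⁺ prodLt n f
factor-∣⁺-prodLt {i} {suc n} {f} f≥0 (s≤s i≤n) with ℕP.m≤n⇒m<n∨m≡n i≤n
... | inj₁ i<n  = ∣⁺-⊗-nonneg (factor-∣⁺-prodLt f≥0 i<n) (f≥0 n)
... | inj₂ refl = factorisation (prodLt n f) (prodLt-nonneg n f≥0) (⊗-comm (prodLt n f) (f n))

prefix-∣⁺-prodLt : ∀ {a L} {f : ℕ → FPS} → (∀ j → NonNeg (f j)) → a ≤ L →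
                   prodLt a f ∣⁺ prodLt L f
prefix-∣⁺-prodLt {a} {L} {f} f≥0 a≤L =
  ∣⁺-respʳ (R.trans (R.sym (prodLt-+ a (L ∸ a) f))
                    (R.reflexive (cong (λ n → prodLt n f) (ℕP.m+[n∸m]≡n a≤L))))
           (∣⁺-⊗-nonneg (∣⁺-refl (prodLt a f)) (prodLt-nonneg (L ∸ a) (λ j → f≥0 (a + j))))

infix 4 _≈[_]_
_≈[_]_ : FPS → ℕ → FPS → Set
f ≈[ N ] g = ∀ i → i ≤ N → f i ≡ g i

⊗-cong-≤ : ∀ {N f f′ g g′} → f ≈[ N ] f′ → g ≈[ N ] g′ → f ⊗ g ≈[ N ] f′ ⊗ g′
⊗-cong-≤ f≈f′ g≈g′ i i≤N = sumTo-cong-≤ i (λ j j≤i →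
  cong₂ ℤ._*_ (f≈f′ j (ℕP.≤-trans j≤i i≤N)) (g≈g′ (i ∸ j) (ℕP.≤-trans (ℕP.m∸n≤m i j) i≤N)))

geo-≈[]-one : ∀ c a N → N < a → geo c a ≈[ N ] one
geo-≈[]-one c a N N<a zero    _   = refl
geo-≈[]-one c a N N<a (suc i) i≤N = geo-vanishes c a (suc i) z<s (ℕP.≤-<-trans i≤N N<a)

prodLt-stable : ∀ {N M L} {f : ℕ → FPS} → (∀ j → M ≤ j → f j ≈[ N ] one) → M ≤ L →
                prodLt L f ≈[ N ] prodLt M f
prodLt-stable {N} {M} {f = f} f≈1 M≤L = go (ℕP.≤⇒≤′ M≤L)
  where
  go : ∀ {L} → M ≤′ L → prodLt L f ≈[ N ] prodLt M f
  go ≤′-refl                _ _   = refl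
  go {suc L} (≤′-step M≤′L) i i≤N =
    trans (⊗-cong-≤ (go M≤′L) (f≈1 L (ℕP.≤′⇒≤ M≤′L)) i i≤N) (coeff (⊗-identityʳ (prodLt M f)) i)

invPochInf-≈[] : ∀ c a d .{{_ : NonZero d}} {N L} → N < L →
                 invPochInf c a d ≈[ N ] invPoch c a d L
invPochInf-≈[] c a d {N} {L} N<L i i≤N =
  sym (prodLt-stable factor≈one (ℕP.≤-trans (s≤s i≤N) N<L) i ℕP.≤-refl)
  where
  factor≈one : ∀ j → suc i ≤ j → geo c (a + d * j) ≈[ i ] one
  factor≈one j i<j = geo-≈[]-one c (a + d * j) i
    (ℕP.<-≤-trans i<j (ℕP.≤-trans (ℕP.m≤n*m j d) (ℕP.m≤n+m (d * j) a)))

-- Two consecutive terms of A₁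

-- Atoms: gn, hn = 1/(1 ± Xm), gb, hb = 1/(1 ± Xb), ha = 1/(1 - Xa), h₁ = 1/(1 - q), and S′ is
-- the inner sum of term n without its last summand Xq gn.  bracket is the sum of terms n and
-- n + 1 of A₁ divided by q^(n²+(4k+1)n+6k) g₀⋯gₙ.
module TermPair (S′ Xq Xm Xa gn hn gb hb ha : FPS) where
  open Solver

  x h₁ Xb Xr S Y Z V un ub bracket : FPS
  x  = X^ 1
  h₁ = geo 1ℤ 1
  Xb = Xm ⊗ x ⊗ x
  Xr = Xq ⊗ x ⊗ x
  S  = S′ ⊕ Xq ⊗ gn
  Y  = (one ⊕ Xb) ⊗ (ha ⊕ Xb)
  Z  = Xb ⊗ Xa ⊗ Xr ⊗ ha
  V  = ha ⊗ (h₁ ⊗ (one ⊖ Xb ⊗ Xb ⊗ Xa))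
       ⊕ Xb ⊗ ha ⊗ (h₁ ⊗ (one ⊖ Xa ⊗ x ⊗ x))
       ⊕ h₁ ⊗ (Xb ⊕ Xb ⊗ Xb)
  un = gn ⊗ hn
  ub = gb ⊗ hb
  bracket = S ⊖ Xb ⊗ Xa ⊗ gb ⊗ (S ⊕ Xr ⊗ gb)

  cleared split Ka Kb Kn : FPS
  cleared = ub ⊗ ub ⊗ (Y ⊗ S ⊖ Z)
  split   = h₁ ⊗ Y ⊗ (gn ⊗ hn ⊗ hn ⊗ S′) ⊕ un ⊗ un ⊗ Xq ⊗ V
  Ka = S ⊗ gb ⊗ hb ⊗ hb ⊗ Xb
  Kb = ⊝ (S ⊗ hb ⊗ hb ⊗ (ha ⊕ gb ⊗ (ha ⊕ Xb)))
  Kn = h₁ ⊗ gn ⊗ hn ⊗ hn ⊗ Z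

  -- Identities of polynomials in the atoms; Ka, Kb and Kn certify that the two sides differ by
  -- a combination of the defects of the relations defining ha, gb and gn.
  clear-b : ha ⊗ hb ⊗ hb ⊗ bracket
            ≈ cleared ⊕ (ha ⊗ (one ⊖ Xa) ⊖ one) ⊗ Ka ⊕ (gb ⊗ (one ⊕ Xb) ⊖ one) ⊗ Kb
  clear-b = solve 7
    (λ S Xb Xa Xr gb hb ha →
      ha :* hb :* hb :* (S :- Xb :* Xa :* gb :* (S :+ Xr :* gb))
      := gb :* hb :* (gb :* hb) :* ((con 1ℤ :+ Xb) :* (ha :+ Xb) :* S :- Xb :* Xa :* Xr :* ha)
         :+ (ha :* (con 1ℤ :- Xa) :- con 1ℤ) :* (S :* gb :* hb :* hb :* Xb)
         :+ (gb :* (con 1ℤ :+ Xb) :- con 1ℤ) :* :- (S :* hb :* hb :* (ha :+ gb :* (ha :+ Xb))))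
    R.refl S Xb Xa Xr gb hb ha

  split-n : gn ⊗ hn ⊗ hn ⊗ h₁ ⊗ (Y ⊗ S ⊖ Z) ≈ split ⊕ (gn ⊗ (one ⊕ Xm) ⊖ one) ⊗ Kn
  split-n = solve 9
    (λ S′ Xq Xm Xa x gn hn ha h₁ →
      let Xb = Xm :* x :* x
          Y  = (con 1ℤ :+ Xb) :* (ha :+ Xb)
          Z  = Xb :* Xa :* (Xq :* x :* x) :* ha
      in gn :* hn :* hn :* h₁ :* (Y :* (S′ :+ Xq :* gn) :- Z)
         := h₁ :* Y :* (gn :* hn :* hn :* S′)
            :+ gn :* hn :* (gn :* hn) :* Xq
               :* (ha :* (h₁ :* (con 1ℤ :- Xb :* Xb :* Xa))
                   :+ Xb :* ha :* (h₁ :* (con 1ℤ :- Xa :* x :* x))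
                   :+ h₁ :* (Xb :+ Xb :* Xb))
            :+ (gn :* (con 1ℤ :+ Xm) :- con 1ℤ) :* (h₁ :* gn :* hn :* hn :* Z))
    R.refl S′ Xq Xm Xa x gn hn ha h₁

  module _ (rel-n : gn ⊗ (one ⊕ Xm) ≈ one) (rel-b : gb ⊗ (one ⊕ Xb) ≈ one)
           (rel-a : ha ⊗ (one ⊖ Xa) ≈ one) where

    bracket-identity : gn ⊗ hn ⊗ hn ⊗ h₁ ⊗ (ha ⊗ hb ⊗ hb ⊗ bracket) ≈ ub ⊗ ub ⊗ split
    bracket-identity = begin
      G ⊗ (ha ⊗ hb ⊗ hb ⊗ bracket)  ≈⟨ R.*-congˡ {G} cleared-b ⟩
      G ⊗ (ub ⊗ ub ⊗ (Y ⊗ S ⊖ Z))   ≈⟨ x∙yz≈y∙xz G (ub ⊗ ub) (Y ⊗ S ⊖ Z) ⟩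
      ub ⊗ ub ⊗ (G ⊗ (Y ⊗ S ⊖ Z))   ≈⟨ R.*-congˡ {ub ⊗ ub} (≈-modulo split Kn rel-n split-n) ⟩
      ub ⊗ ub ⊗ split               ∎
      where
      open ≈-Reasoning
      G : FPS
      G = gn ⊗ hn ⊗ hn ⊗ h₁
      cleared-b : ha ⊗ hb ⊗ hb ⊗ bracket ≈ cleared
      cleared-b = ≈-modulo cleared Ka rel-a
                    (≈-modulo (cleared ⊕ (ha ⊗ (one ⊖ Xa) ⊖ one) ⊗ Ka) Kb rel-b clear-b)

    bracket-nonneg : ∀ {Q} → NonNeg Q → NonNeg (Q ⊗ (gn ⊗ hn ⊗ hn) ⊗ S′) →
                     Monomial Xq → Monomial Xm → Monomial Xa →
                     NonNeg ha → NonNeg un → NonNeg ub →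
                     NonNeg (Q ⊗ (gn ⊗ hn ⊗ hn ⊗ h₁ ⊗ (ha ⊗ hb ⊗ hb ⊗ bracket)))
    bracket-nonneg {Q} Q≥0 QwS′≥0 Xq-mon Xm-mon Xa-mon ha≥0 un≥0 ub≥0 =
      nonneg-resp (R.sym (R.trans (R.*-congˡ {Q} bracket-identity) regroup))
        (nonneg-⊕ (nonneg-⊗ (nonneg-⊗ (nonneg-⊗ ub²≥0 h₁≥0) Y≥0) QwS′≥0)
                  (nonneg-⊗ (nonneg-⊗ Q≥0 ub²≥0)
                            (nonneg-⊗ (nonneg-⊗ (nonneg-⊗ un≥0 un≥0) (monomial-nonneg Xq-mon))
                                      V≥0)))
      where
      x-mon : Monomial x
      x-mon = monomial-X^ 1
      Xb-mon : Monomial Xb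
      Xb-mon = monomial-⊗ (monomial-⊗ Xm-mon x-mon) x-mon
      Xb≥0 : NonNeg Xb
      Xb≥0 = monomial-nonneg Xb-mon
      h₁≥0 : NonNeg h₁
      h₁≥0 = geo-1ℤ-nonneg 1
      one≥0 : NonNeg one
      one≥0 = monomial-nonneg (monomial-X^ 0)
      ub²≥0 : NonNeg (ub ⊗ ub)
      ub²≥0 = nonneg-⊗ ub≥0 ub≥0
      poly≥0 : ∀ {f} → Monomial f → NonNeg (h₁ ⊗ (one ⊖ f))
      poly≥0 = geo-1ℤ-1⊗[one⊖monomial]-nonneg
      Y≥0 : NonNeg Y
      Y≥0 = nonneg-⊗ (nonneg-⊕ one≥0 Xb≥0) (nonneg-⊕ ha≥0 Xb≥0)
      V≥0 : NonNeg V
      V≥0 = nonneg-⊕ (nonneg-⊕ (nonneg-⊗ ha≥0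
                                           (poly≥0 (monomial-⊗ (monomial-⊗ Xb-mon Xb-mon) Xa-mon)))
                               (nonneg-⊗ (nonneg-⊗ Xb≥0 ha≥0)
                                         (poly≥0 (monomial-⊗ (monomial-⊗ Xa-mon x-mon) x-mon))))
                     (nonneg-⊗ h₁≥0 (nonneg-⊕ Xb≥0 (nonneg-⊗ Xb≥0 Xb≥0)))
      regroup : Q ⊗ (ub ⊗ ub ⊗ split)
                ≈ ub ⊗ ub ⊗ h₁ ⊗ Y ⊗ (Q ⊗ (gn ⊗ hn ⊗ hn) ⊗ S′)
                  ⊕ Q ⊗ (ub ⊗ ub) ⊗ (un ⊗ un ⊗ Xq ⊗ V)
      regroup = solve 7 (λ Q U h₁ Y W S′ P → Q :* (U :* (h₁ :* Y :* (W :* S′) :+ P))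
                                          := U :* h₁ :* Y :* (Q :* W :* S′) :+ Q :* U :* P)
                        R.refl Q (ub ⊗ ub) h₁ Y (gn ⊗ hn ⊗ hn) S′ (un ⊗ un ⊗ Xq ⊗ V)

[-1]^[t+t] : ∀ t → (- 1ℤ) ℤ.^ (t + t) ≡ 1ℤ
[-1]^[t+t] zero    = refl
[-1]^[t+t] (suc t) rewrite ℕP.+-suc t t | [-1]^[t+t] t = refl

[-1]^[2+t+t] : ∀ t → (- 1ℤ) ℤ.^ (2 + (t + t)) ≡ 1ℤ
[-1]^[2+t+t] t rewrite [-1]^[t+t] t = refl

[-1]^[3+t+t] : ∀ t → (- 1ℤ) ℤ.^ (3 + (t + t)) ≡ - 1ℤ
[-1]^[3+t+t] t rewrite [-1]^[t+t] t = refl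

private
  F-exponent : ∀ i k → 2 * i + 2 * k + 1 ≡ 2 * k + 1 + 2 * i
  F-exponent = solve-∀

  h-exponent : ∀ k j → 1 + 2 * (k + j) ≡ 2 * k + 1 + 2 * j
  h-exponent = solve-∀

  m-suc : ∀ k j → 2 * k + 1 + 2 * suc j ≡ 2 * k + 1 + 2 * j + 1 + 1
  m-suc = solve-∀

  q-suc : ∀ n → 2 * suc n + 1 ≡ 2 * n + 1 + 1 + 1
  q-suc = solve-∀

  E-suc : ∀ k′ n → let k = suc k′ in
          suc n * suc n + (4 * k + 1) * suc n + 6 * k
          ≡ n * n + (4 * k + 1) * n + 6 * k + (2 * k + 1 + 2 * suc n + (1 + 2 * k′))
  E-suc = solve-∀

truncatedDenomInv : ℕ → FPS
truncatedDenomInv L =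
  invPoch 1ℤ 1 2 L ⊗ invPoch 1ℤ 1 2 L ⊗ invPoch 1ℤ 2 2 L ⊗ invPoch 1ℤ 4 4 L ⊗ invPoch 1ℤ 4 4 L

module ConsecutiveTerms (k′ t : ℕ) where
  k n : ℕ
  k = suc k′
  n = suc (t + t)

  m E : ℕ → ℕ
  m j = 2 * k + 1 + 2 * j
  E j = j * j + (4 * k + 1) * j + 6 * k

  g o h w F : ℕ → FPS
  g j = geo (- 1ℤ) (m j)
  o j = geo 1ℤ (1 + 2 * j)
  h j = o (k + j)
  w j = g j ⊗ h j ⊗ h j
  F i = X^ (2 * i + 1) ⊗ geo (- 1ℤ) (2 * i + 2 * k + 1)

  Xq Xm Xa : FPS
  Xq = X^ (2 * n + 1)
  Xm = X^ (m n)
  Xa = X^ (1 + 2 * k′)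

  open TermPair (sumS (t + t) F) Xq Xm Xa (g n) (h n) (g (suc n)) (h (suc n)) (o k′)

  Xe P′ Hn′ H Q pair : FPS
  Xe  = X^ (E n)
  P′  = prodLt n g
  Hn′ = prodLt n h
  H   = prodLt (suc (suc n)) h
  Q   = Xe ⊗ (P′ ⊗ Hn′ ⊗ Hn′)
  pair = A1term k n ⊕ A1term k (suc n)

  F≈ : ∀ i → F i ≈ X^ (2 * i + 1) ⊗ g i
  F≈ i = R.*-congˡ {X^ (2 * i + 1)} (R.reflexive (cong (geo (- 1ℤ)) (F-exponent i k)))

  u-nonneg : ∀ j → NonNeg (g j ⊗ h j)
  u-nonneg j = nonneg-resp (R.*-congˡ {g j} (R.reflexive (cong (geo 1ℤ) (sym (h-exponent k j)))))
                           (geo-[-1ℤ]⊗geo-1ℤ-nonneg (m j))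

  w-nonneg : ∀ j → NonNeg (w j)
  w-nonneg j = nonneg-⊗ (u-nonneg j) (geo-1ℤ-nonneg _)

  Xb≈ : X^ (m (suc n)) ≈ Xb
  Xb≈ = R.trans (R.reflexive (cong X^ (m-suc k n))) (X^-+1+1 (m n))

  sumS≈S : sumS n F ≈ S
  sumS≈S = R.+-congˡ {sumS (t + t) F} (F≈ n)

  first-term : A1term k n ≈ Xe ⊗ (P′ ⊗ g n) ⊗ S
  first-term =
    R.*-cong (R.*-congʳ {P′ ⊗ g n} (R.reflexive (cong (flip mono (E n)) ([-1]^[2+t+t] t))))
             sumS≈S

  second-term : A1term k (suc n)
                ≈ ⊝ (Xe ⊗ (Xb ⊗ Xa)) ⊗ (P′ ⊗ g n ⊗ g (suc n)) ⊗ (S ⊕ Xr ⊗ g (suc n))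
  second-term = R.*-cong (R.*-congʳ {P′ ⊗ g n ⊗ g (suc n)} sign)
                         (R.+-cong sumS≈S (R.trans (F≈ (suc n)) (R.*-congʳ {g (suc n)} Xr≈)))
    where
    open ≈-Reasoning
    Xr≈ : X^ (2 * suc n + 1) ≈ Xr
    Xr≈ = R.trans (R.reflexive (cong X^ (q-suc n))) (X^-+1+1 (2 * n + 1))
    sign : mono ((- 1ℤ) ℤ.^ suc (suc n)) (E (suc n)) ≈ ⊝ (Xe ⊗ (Xb ⊗ Xa))
    sign = begin
      mono ((- 1ℤ) ℤ.^ suc (suc n)) (E (suc n))  ≡⟨ cong (flip mono (E (suc n))) ([-1]^[3+t+t] t) ⟩
      mono (- 1ℤ) (E (suc n))                    ≈⟨ coeffwise (mono-neg 1ℤ (E (suc n))) ⟩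
      ⊝ X^ (E (suc n))                           ≡⟨ cong (λ e → ⊝ X^ e) (E-suc k′ n) ⟩
      ⊝ X^ (E n + (m (suc n) + (1 + 2 * k′)))    ≈⟨ R.-‿cong (X^-+ (E n) _) ⟩
      ⊝ (Xe ⊗ X^ (m (suc n) + (1 + 2 * k′)))     ≈⟨ R.-‿cong (R.*-congˡ {Xe} (X^-+ (m (suc n)) _)) ⟩
      ⊝ (Xe ⊗ (X^ (m (suc n)) ⊗ Xa))             ≈⟨ R.-‿cong (R.*-congˡ {Xe} (R.*-congʳ {Xa} Xb≈)) ⟩
      ⊝ (Xe ⊗ (Xb ⊗ Xa))                         ∎

  pair≈ : pair ≈ Xe ⊗ P′ ⊗ g n ⊗ bracket
  pair≈ = R.trans (R.+-cong first-term second-term)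
    (solve 8 (λ Xe P′ gn gb S Xb Xa Xr →
               Xe :* (P′ :* gn) :* S :+ :- (Xe :* (Xb :* Xa)) :* (P′ :* gn :* gb) :* (S :+ Xr :* gb)
               := Xe :* P′ :* gn :* (S :- Xb :* Xa :* gb :* (S :+ Xr :* gb)))
             R.refl Xe P′ (g n) (g (suc n)) S Xb Xa Xr)
    where open Solver

  P′Hn′Hn′≈ : P′ ⊗ Hn′ ⊗ Hn′ ≈ prodLt n w
  P′Hn′Hn′≈ = R.trans (R.*-congʳ {Hn′} (prodLt-⊗ n g h)) (prodLt-⊗ n (λ j → g j ⊗ h j) h)

  Q-nonneg : NonNeg Q
  Q-nonneg = nonneg-⊗ (monomial-nonneg (monomial-X^ (E n)))
                      (nonneg-resp (R.sym P′Hn′Hn′≈) (prodLt-nonneg n w-nonneg))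

  Fw-nonneg : ∀ i → NonNeg (F i ⊗ w i)
  Fw-nonneg i = nonneg-resp (R.sym (R.trans (R.*-congʳ {w i} (F≈ i)) regroup))
    (nonneg-⊗ (nonneg-⊗ (monomial-nonneg (monomial-X^ (2 * i + 1))) (u-nonneg i)) (u-nonneg i))
    where
    regroup : X^ (2 * i + 1) ⊗ g i ⊗ w i ≈ X^ (2 * i + 1) ⊗ (g i ⊗ h i) ⊗ (g i ⊗ h i)
    regroup = solve 3 (λ X g h → X :* g :* (g :* h :* h) := X :* (g :* h) :* (g :* h))
                      R.refl (X^ (2 * i + 1)) (g i) (h i)
      where open Solver

  QwS′-nonneg : NonNeg (Q ⊗ (g n ⊗ h n ⊗ h n) ⊗ sumS (t + t) F)
  QwS′-nonneg = nonneg-resp (R.sym regroup)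
    (nonneg-⊗ (monomial-nonneg (monomial-X^ (E n)))
              (nonneg-⊗-sumS (t + t) F {prodLt (suc n) w} λ i i≤t+t →
                 nonneg-resp (⊗-comm (F i) (prodLt (suc n) w))
                   (nonneg-∣⁺ (F i) (Fw-nonneg i)
                              (factor-∣⁺-prodLt w-nonneg (s≤s (ℕP.m≤n⇒m≤1+n i≤t+t))))))
    where
    regroup : Q ⊗ w n ⊗ sumS (t + t) F ≈ Xe ⊗ (prodLt (suc n) w ⊗ sumS (t + t) F)
    regroup = R.trans (R.*-congʳ {sumS (t + t) F}
                        (R.trans (R.*-assoc Xe (P′ ⊗ Hn′ ⊗ Hn′) (w n))
                                 (R.*-congˡ {Xe} (R.*-congʳ {w n} P′Hn′Hn′≈))))
                      (R.*-assoc Xe (prodLt (suc n) w) (sumS (t + t) F))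

  pair⊗factors-nonneg : NonNeg (pair ⊗ ((h₁ ⊗ H) ⊗ (o k′ ⊗ H)))
  pair⊗factors-nonneg = nonneg-resp (R.sym regroup)
    (bracket-nonneg (geo-[-1ℤ]-inverse (m n))
                    (R.trans (R.*-congˡ {g (suc n)} (R.+-congˡ {one} (R.sym Xb≈)))
                             (geo-[-1ℤ]-inverse (m (suc n))))
                    (geo-inverse 1ℤ (1 + 2 * k′))
                    Q-nonneg QwS′-nonneg
                    (monomial-X^ (2 * n + 1)) (monomial-X^ (m n)) (monomial-X^ (1 + 2 * k′))
                    (geo-1ℤ-nonneg _) (u-nonneg n) (u-nonneg (suc n)))
    where
    regroup : pair ⊗ ((h₁ ⊗ H) ⊗ (o k′ ⊗ H))
              ≈ Q ⊗ (g n ⊗ h n ⊗ h n ⊗ h₁ ⊗ (o k′ ⊗ h (suc n) ⊗ h (suc n) ⊗ bracket))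
    regroup = R.trans (R.*-congʳ {(h₁ ⊗ H) ⊗ (o k′ ⊗ H)} pair≈)
      (solve 9 (λ Xe P′ gn B Hn′ hn hb h₁ ha →
                 Xe :* P′ :* gn :* B :* ((h₁ :* (Hn′ :* hn :* hb)) :* (ha :* (Hn′ :* hn :* hb)))
                 := Xe :* (P′ :* Hn′ :* Hn′) :* (gn :* hn :* hn :* h₁ :* (ha :* hb :* hb :* B)))
               R.refl Xe P′ (g n) bracket Hn′ (h n) (h (suc n)) h₁ (o k′))
      where open Solver

  -- h₁ = o 0 and o k′ are taken from different copies of 1/(q;q²)∞: they coincide when k = 1.
  factors-∣⁺-denominator : ∀ {L} → k + suc (suc n) ≤ L →
                           (h₁ ⊗ H) ⊗ (o k′ ⊗ H) ∣⁺ truncatedDenomInv L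
  factors-∣⁺-denominator {L} bound =
    ∣⁺-⊗-nonneg (∣⁺-⊗-nonneg (∣⁺-⊗-nonneg
      (∣⁺-⊗ (with-H (factor-∣⁺-prodLt {0} {k} {o} o-nonneg (s≤s z≤n)))
            (with-H (factor-∣⁺-prodLt {k′} {k} {o} o-nonneg ℕP.≤-refl)))
      (invPoch-nonneg 2 2)) (invPoch-nonneg 4 4)) (invPoch-nonneg 4 4)
    where
    o-nonneg : ∀ j → NonNeg (o j)
    o-nonneg j = geo-1ℤ-nonneg _
    invPoch-nonneg : ∀ a d → NonNeg (invPoch 1ℤ a d L)
    invPoch-nonneg a d = prodLt-nonneg L (λ j → geo-1ℤ-nonneg _)
    with-H : ∀ {f} → f ∣⁺ prodLt k o → f ⊗ H ∣⁺ prodLt L o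
    with-H f∣ = ∣⁺-trans (∣⁺-respʳ (R.sym (prodLt-+ k (suc (suc n)) o)) (∣⁺-⊗ f∣ (∣⁺-refl H)))
                         (prefix-∣⁺-prodLt o-nonneg bound)

  pair-nonneg : ∀ {L} → k + suc (suc n) ≤ L → NonNeg (pair ⊗ truncatedDenomInv L)
  pair-nonneg bound = nonneg-∣⁺ pair pair⊗factors-nonneg (factors-∣⁺-denominator bound)

pairSum : ℕ → ℕ → FPS
pairSum k zero    = 0S
pairSum k (suc M) = pairSum k M ⊕ (A1term k (suc (M + M)) ⊕ A1term k (suc (suc (M + M))))

pairSum-nonneg : ∀ k′ M {L} → suc k′ + suc (M + M) ≤ L →
                 NonNeg (pairSum (suc k′) M ⊗ truncatedDenomInv L)
pairSum-nonneg k′ zero    {L} _     =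
  nonneg-resp (R.sym (R.zeroˡ (truncatedDenomInv L))) (coeffwise-≥0 λ _ → ℤP.≤-refl)
pairSum-nonneg k′ (suc M) {L} bound =
  nonneg-resp (R.sym (⊗-distribʳ-⊕ (truncatedDenomInv L) (pairSum (suc k′) M)
                                   (ConsecutiveTerms.pair k′ M)))
    (nonneg-⊕ (pairSum-nonneg k′ M (ℕP.≤-trans (ℕP.+-monoʳ-≤ (suc k′) (ℕP.m≤n+m _ 2)) bound′))
              (ConsecutiveTerms.pair-nonneg k′ M bound′))
  where
  bound′ : suc k′ + (2 + suc (M + M)) ≤ L
  bound′ = subst (λ z → suc k′ + suc (suc z) ≤ L) (ℕP.+-suc M M) bound

A1term-vanishes : ∀ k n i → i < n → A1term k n i ≡ 0ℤ
A1term-vanishes k n i i<n =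
  trans (coeff (⊗-assoc (mono s e) P S) i) (mono-⊗-< s e (P ⊗ S) i (ℕP.<-≤-trans i<n n≤e))
  where
  s : ℤ
  s = (- 1ℤ) ℤ.^ suc n
  e : ℕ
  e = n * n + (4 * k + 1) * n + 6 * k
  P S : FPS
  P = invPoch (- 1ℤ) (2 * k + 1) 2 (suc n)
  S = sumS n (λ i → X^ (2 * i + 1) ⊗ geo (- 1ℤ) (2 * i + 2 * k + 1))
  n≤e : n ≤ e
  n≤e = ℕP.≤-trans (ℕP.≤-trans (ℕP.≤-reflexive (sym (ℕP.*-identityˡ n)))
                               (ℕP.*-monoˡ-≤ n (ℕP.m≤n+m 1 (4 * k))))
                   (ℕP.≤-trans (ℕP.m≤n+m _ (n * n)) (ℕP.m≤m+n _ (6 * k)))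

A1-≈[]-pairSum : ∀ k N → A1 k ≈[ N ] pairSum k N
A1-≈[]-pairSum k N i i≤N =
  trans (sym (sumTo-trailing-zeros (ℕP.≤-trans i≤N (ℕP.m≤m+n N N)) beyond-i)) (pairing N)
  where
  term : ℕ → ℤ
  term n = if n ≡ᵇ 0 then 0ℤ else A1term k n i
  beyond-i : ∀ n → i < n → n ≤ N + N → term n ≡ 0ℤ
  beyond-i (suc n) i<n _ = A1term-vanishes k (suc n) i i<n
  pairing : ∀ M → sumTo (M + M) term ≡ pairSum k M i
  pairing zero    = refl
  pairing (suc M) rewrite ℕP.+-suc M M | pairing M = ℤP.+-assoc (pairSum k M i) _ _

denomInv-≈[] : ∀ {N L} → N < L → denomInv ≈[ N ] truncatedDenomInv L
denomInv-≈[] {N} {L} N<L =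
  ⊗-cong-≤ (⊗-cong-≤ (⊗-cong-≤ (⊗-cong-≤ (approx 1 2) (approx 1 2)) (approx 2 2)) (approx 4 4))
           (approx 4 4)
  where
  approx : ∀ a d .{{_ : NonZero d}} → invPochInf 1ℤ a d ≈[ N ] invPoch 1ℤ a d L
  approx a d = invPochInf-≈[] 1ℤ a d N<L

lemma3p4 : (k : ℕ) → 1 ≤ k → (N : ℕ) → 0ℤ ≤ℤ (A1 k ⊗ denomInv) N
lemma3p4 (suc k′) _ N =
  subst (0ℤ ≤ℤ_) (sym (⊗-cong-≤ (A1-≈[]-pairSum (suc k′) N) (denomInv-≈[] N<L) N ℕP.≤-refl))
        (coeff-≥0 (pairSum-nonneg k′ N ℕP.≤-refl) N)
  where
  N<L : N < suc k′ + suc (N + N)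
  N<L = ℕP.≤-trans (s≤s (ℕP.m≤m+n N N)) (ℕP.m≤n+m _ (suc k′))
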